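{- Let $Q:\mathsf{C}\to\mathsf{SLatt}$ be a functor and let $F:\mathsf{C}\to\mathsf{C}$ have a lifting $\overline F$ to $\int Q$, with corresponding lax natural family $\psi_X:Q(X)\to Q(F(X))$. (1) If $F$ has a terminal coalgebra $(\nu F,\chi)$, let $\phi:=Q(\chi^{ -1})\circ\psi_{\nu F}:Q(\nu F)\to Q(\nu F)$ and let $\nu.\phi$ be its greatest fixed point. Then $\chi:(\nu F,\nu.\phi)\to\overline F(\nu F,\nu.\phi)$ is a terminal $\overline F$-coalgebra. (2) If $\psi$ is natural and $F$ has an initial algebra $(\mu F,\chi)$, let $\phi:=Q(\chi)\circ\psi_{\mu F}:Q(\mu F)\to Q(\mu F)$ and let $\mu.\phi$ be its least fixed point. Then $\chi:\overline F(\mu F,\mu.\phi)\to(\mu F,\mu.\phi)$ is an initial $\overline F$-algebra.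
   Context: $Q:\mathsf{C}\to\mathsf{SLatt}$: each $Q(X)$ is a complete lattice and each $Q(f)$ preserves all suprema. $\int Q$ has objects $(X,\alpha)$, $\alpha\in Q(X)$, and arrows $f:(X,\alpha)\to(Y,\beta)$ the arrows $f:X\to Y$ with $Q(f)(\alpha)\le\beta$; $\pi$ is the projection. A lifting $\overline F$ of $F$ ($\pi\circ\overline F=F\circ\pi$) corresponds to monotone (not necessarily sup-preserving) maps $\psi_X:Q(X)\to Q(F(X))$ with $Q(F(f))(\psi_X(\alpha))\le\psi_Y(Q(f)(\alpha))$, via $\overline F(X,\alpha)=(F(X),\psi_X(\alpha))$, $\overline F(f)=F(f)$; $\psi$ natural means equality. Coalgebras/algebras and their morphisms are the usual ones: an $F$-coalgebra is $\gamma:X\to F(X)$, morphisms $f$ with $\delta\circ f=F(f)\circ\gamma$; an $F$-algebra is $\gamma:F(X)\to X$, morphisms $f$ with $f\circ\gamma=\delta\circ F(f)$. The structure maps of terminal coalgebras and initial algebras are invertible; greatest/least fixed points of monotone self-maps of complete lattices exist by Knaster–Tarski. -}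

module Defs where

open import Level using (Level; _⊔_; Lift; lift) renaming (suc to lsuc)
open import Relation.Binary.PropositionalEquality
open import Data.Product using (Σ; _×_; _,_; proj₁; proj₂)
open import Data.Bool using (Bool; true; false)

record Category (o h : Level) : Set (lsuc (o ⊔ h)) where
  infixr 9 _∘_
  field
    Obj : Set o
    Hom : Obj → Obj → Set h
    idC : ∀ {A} → Hom A A
    _∘_ : ∀ {A B C} → Hom B C → Hom A B → Hom A C
    identityˡ : ∀ {A B} {f : Hom A B} → idC ∘ f ≡ f
    identityʳ : ∀ {A B} {f : Hom A B} → f ∘ idC ≡ f
    assoc : ∀ {A B C D} {f : Hom A B} {g : Hom B C} {k : Hom C D} →
            (k ∘ g) ∘ f ≡ k ∘ (g ∘ f)

record Functor {o h o′ h′ : Level} (C : Category o h) (D : Category o′ h′)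
       : Set (o ⊔ h ⊔ o′ ⊔ h′) where
  private
    module C = Category C
    module D = Category D
  field
    F₀ : C.Obj → D.Obj
    F₁ : ∀ {A B} → C.Hom A B → D.Hom (F₀ A) (F₀ B)
    F-id : ∀ {A} → F₁ (C.idC {A}) ≡ D.idC
    F-∘ : ∀ {A B E} (f : C.Hom A B) (g : C.Hom B E) →
          F₁ (g C.∘ f) ≡ F₁ g D.∘ F₁ f

module _ {o h : Level} {C : Category o h} (F : Functor C C) where
  open Category C
  open Functor F

  record Coalgebra : Set (o ⊔ h) where
    constructor coalg
    field
      carrier : Obj
      str : Hom carrier (F₀ carrier)

  record CoalgHom (A B : Coalgebra) : Set h where
    field
      arr : Hom (Coalgebra.carrier A) (Coalgebra.carrier B)
      comm : Coalgebra.str B ∘ arr ≡ F₁ arr ∘ Coalgebra.str A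

  IsTerminalCoalgebra : Coalgebra → Set (o ⊔ h)
  IsTerminalCoalgebra T =
    (A : Coalgebra) → Σ (CoalgHom A T) λ u →
      (v : CoalgHom A T) → CoalgHom.arr v ≡ CoalgHom.arr u

  record Algebra : Set (o ⊔ h) where
    constructor alg
    field
      carrier : Obj
      str : Hom (F₀ carrier) carrier

  record AlgHom (A B : Algebra) : Set h where
    field
      arr : Hom (Algebra.carrier A) (Algebra.carrier B)
      comm : arr ∘ Algebra.str A ≡ Algebra.str B ∘ F₁ arr

  IsInitialAlgebra : Algebra → Set (o ⊔ h)
  IsInitialAlgebra I =
    (A : Algebra) → Σ (AlgHom I A) λ u →
      (v : AlgHom I A) → AlgHom.arr v ≡ AlgHom.arr u

record CompleteLattice (c ℓ : Level) : Set (lsuc (c ⊔ ℓ)) where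
  field
    Carrier : Set c
    _≤_ : Carrier → Carrier → Set ℓ
    ≤-refl : ∀ {x} → x ≤ x
    ≤-trans : ∀ {x y z} → x ≤ y → y ≤ z → x ≤ z
    ≤-antisym : ∀ {x y} → x ≤ y → y ≤ x → x ≡ y
    ⋁ : {I : Set (c ⊔ ℓ)} → (I → Carrier) → Carrier
    ⋁-upper : ∀ {I : Set (c ⊔ ℓ)} (g : I → Carrier) (i : I) → g i ≤ ⋁ g
    ⋁-least : ∀ {I : Set (c ⊔ ℓ)} (g : I → Carrier) (x : Carrier) →
              (∀ i → g i ≤ x) → ⋁ g ≤ x

module _ {c ℓ : Level} (L : CompleteLattice c ℓ) where
  open CompleteLattice L

  IsGreatestFixedPoint : (Carrier → Carrier) → Carrier → Set (c ⊔ ℓ)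
  IsGreatestFixedPoint φ g = (φ g ≡ g) × (∀ x → φ x ≡ x → x ≤ g)

  IsLeastFixedPoint : (Carrier → Carrier) → Carrier → Set (c ⊔ ℓ)
  IsLeastFixedPoint φ l = (φ l ≡ l) × (∀ x → φ x ≡ x → l ≤ x)

record SLattFunctor {o h : Level} (C : Category o h) (c ℓ : Level)
       : Set (o ⊔ h ⊔ lsuc (c ⊔ ℓ)) where
  open Category C
  field
    Q₀ : Obj → CompleteLattice c ℓ
    Q₁ : ∀ {X Y} → Hom X Y →
         CompleteLattice.Carrier (Q₀ X) → CompleteLattice.Carrier (Q₀ Y)
    Q₁-⋁ : ∀ {X Y} (f : Hom X Y) {I : Set (c ⊔ ℓ)}
           (g : I → CompleteLattice.Carrier (Q₀ X)) →
           Q₁ f (CompleteLattice.⋁ (Q₀ X) g)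
             ≡ CompleteLattice.⋁ (Q₀ Y) (λ i → Q₁ f (g i))
    Q-id : ∀ {X} (x : CompleteLattice.Carrier (Q₀ X)) → Q₁ (idC {X}) x ≡ x
    Q-∘ : ∀ {X Y Z} (f : Hom X Y) (g : Hom Y Z)
          (x : CompleteLattice.Carrier (Q₀ X)) →
          Q₁ (g ∘ f) x ≡ Q₁ g (Q₁ f x)

module _ {o h c ℓ : Level} {C : Category o h} (Q : SLattFunctor C c ℓ) where
  open Category C
  open SLattFunctor Q

  ∣_∣ : Obj → Set c
  ∣ X ∣ = CompleteLattice.Carrier (Q₀ X)

  Q₁-mono : ∀ {X Y} (f : Hom X Y) {a b : ∣ X ∣} →
            CompleteLattice._≤_ (Q₀ X) a b →
            CompleteLattice._≤_ (Q₀ Y) (Q₁ f a) (Q₁ f b)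
  Q₁-mono {X} {Y} f {a} {b} a≤b =
    subst (λ z → LY._≤_ (Q₁ f a) z) (sym eqY)
      (LY.⋁-upper (λ i → Q₁ f (g i)) (lift false))
    where
      module LX = CompleteLattice (Q₀ X)
      module LY = CompleteLattice (Q₀ Y)
      g : Lift (c ⊔ ℓ) Bool → LX.Carrier
      g (lift true) = b
      g (lift false) = a
      g≤b : ∀ i → g i LX.≤ b
      g≤b (lift true) = LX.≤-refl
      g≤b (lift false) = a≤b
      eqX : LX.⋁ g ≡ b
      eqX = LX.≤-antisym (LX.⋁-least g b g≤b) (LX.⋁-upper g (lift true))
      eqY : Q₁ f b ≡ LY.⋁ (λ i → Q₁ f (g i))
      eqY = trans (cong (Q₁ f) (sym eqX)) (Q₁-⋁ f g)

  ∫Obj : Set (o ⊔ c)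
  ∫Obj = Σ Obj λ X → ∣ X ∣

  -- arrows (X,α) → (Y,β): arrows f : X → Y with Q(f)(α) ≤ β
  -- (the inequality is a property, hence irrelevant)
  record ∫Hom (A B : ∫Obj) : Set (h ⊔ ℓ) where
    constructor ∫arr
    field
      arr : Hom (proj₁ A) (proj₁ B)
      .le : CompleteLattice._≤_ (Q₀ (proj₁ B)) (Q₁ arr (proj₂ A)) (proj₂ B)
  open ∫Hom public

  ∫≡ : ∀ {A B} {u v : ∫Hom A B} → arr u ≡ arr v → u ≡ v
  ∫≡ {u = ∫arr f _} {v = ∫arr .f _} refl = refl

  ∫Q : Category (o ⊔ c) (h ⊔ ℓ)
  ∫Q = record
    { Obj = ∫Obj
    ; Hom = ∫Hom
    ; idC = λ {A} → ∫arr idC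
              (subst (λ z → CompleteLattice._≤_ (Q₀ (proj₁ A)) z (proj₂ A))
                     (sym (Q-id (proj₂ A)))
                     (CompleteLattice.≤-refl (Q₀ (proj₁ A))))
    ; _∘_ = λ { {A} {B} {E} (∫arr g p) (∫arr f q) → ∫arr (g ∘ f)
              (subst (λ z → CompleteLattice._≤_ (Q₀ (proj₁ E)) z (proj₂ E))
                     (sym (Q-∘ f g (proj₂ A)))
                     (CompleteLattice.≤-trans (Q₀ (proj₁ E))
                        (Q₁-mono g q) p)) }
    ; identityˡ = ∫≡ identityˡ
    ; identityʳ = ∫≡ identityʳ
    ; assoc = ∫≡ assoc
    }

  module _ (F : Functor C C) where
    open Functor F

    record LaxFamily : Set (o ⊔ h ⊔ c ⊔ ℓ) where
      field
        ψ : ∀ X → ∣ X ∣ → ∣ F₀ X ∣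
        ψ-mono : ∀ X {a b : ∣ X ∣} → CompleteLattice._≤_ (Q₀ X) a b →
                 CompleteLattice._≤_ (Q₀ (F₀ X)) (ψ X a) (ψ X b)
        ψ-lax : ∀ {X Y} (f : Hom X Y) (a : ∣ X ∣) →
                CompleteLattice._≤_ (Q₀ (F₀ Y)) (Q₁ (F₁ f) (ψ X a)) (ψ Y (Q₁ f a))

    IsNatural : LaxFamily → Set (o ⊔ h ⊔ c)
    IsNatural Ψ = ∀ {X Y} (f : Hom X Y) (a : ∣ X ∣) →
                  Q₁ (F₁ f) (LaxFamily.ψ Ψ X a) ≡ LaxFamily.ψ Ψ Y (Q₁ f a)

    lifting : LaxFamily → Functor ∫Q ∫Q
    lifting Ψ = record
      { F₀ = λ A → F₀ (proj₁ A) , ψ (proj₁ A) (proj₂ A)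
      ; F₁ = λ { {A} {B} (∫arr f p) → ∫arr (F₁ f)
                 (CompleteLattice.≤-trans (Q₀ (F₀ (proj₁ B)))
                    (ψ-lax f (proj₂ A)) (ψ-mono (proj₁ B) p)) }
      ; F-id = ∫≡ F-id
      ; F-∘ = λ f g → ∫≡ (F-∘ (arr f) (arr g))
      }
      where open LaxFamily Ψ

{-# OPTIONS --safe #-}
-- The (co)universal property of χ in C transfers to ∫Q as soon as the unique
-- mediating arrow u respects the labels. For a lifted coalgebra (X, α, γ),
-- laxness of ψ makes Q(u)(α) a post-fixed point of φ, hence below ν.φ by
-- Knaster–Tarski. For a lifted algebra, naturality of ψ gives
-- Q(u) ∘ φ = Q(γ) ∘ ψ_X ∘ Q(u), so the right adjoint of the sup-preserving map
-- Q(u), evaluated at α, is a pre-fixed point of φ and therefore lies above μ.φ.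
module Submission where

open import Defs
open import Level using (Level; _⊔_)
open import Function using (_∘′_)
open import Relation.Binary.Bundles using (Poset)
open import Relation.Binary.PropositionalEquality
  using (_≡_; refl; sym; cong; isEquivalence; module ≡-Reasoning)
open import Data.Product using (Σ; _×_; _,_; proj₁; proj₂)
import Relation.Binary.Reasoning.PartialOrder as PosetReasoning

module CompleteLatticeProperties {c ℓ : Level} (L : CompleteLattice c ℓ) where
  open CompleteLattice L

  ≤-reflexive : ∀ {x y} → x ≡ y → x ≤ y
  ≤-reflexive refl = ≤-refl

  poset : Poset c c ℓ
  poset = record
    { _≈_ = _≡_
    ; _≤_ = _≤_
    ; isPartialOrder = record
      { isPreorder = record
        { isEquivalence = isEquivalence ; reflexive = ≤-reflexive ; trans = ≤-trans }
      ; antisym = ≤-antisym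
      }
    }

  module ≤-Reasoning = PosetReasoning poset

  module KnasterTarski (φ : Carrier → Carrier) (φ-mono : ∀ {a b} → a ≤ b → φ a ≤ φ b) where

    PostFixed : Set (c ⊔ ℓ)
    PostFixed = Σ Carrier λ x → x ≤ φ x

    ν : Carrier
    ν = ⋁ {I = PostFixed} proj₁

    ν-postfixed : ν ≤ φ ν
    ν-postfixed = ⋁-least proj₁ (φ ν) λ (x , x≤φx) →
      ≤-trans x≤φx (φ-mono (⋁-upper proj₁ (x , x≤φx)))

    ν-fixed : φ ν ≡ ν
    ν-fixed = ≤-antisym (⋁-upper proj₁ (φ ν , φ-mono ν-postfixed)) ν-postfixed

    postfixed≤gfp : ∀ {g x} → IsGreatestFixedPoint L φ g → x ≤ φ x → x ≤ g
    postfixed≤gfp (_ , greatest) x≤φx = ≤-trans (⋁-upper proj₁ (_ , x≤φx)) (greatest ν ν-fixed)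

    LowerBoundOfPreFixed : Set (c ⊔ ℓ)
    LowerBoundOfPreFixed = Σ Carrier λ x → ∀ y → φ y ≤ y → x ≤ y

    μ : Carrier
    μ = ⋁ {I = LowerBoundOfPreFixed} proj₁

    μ≤prefixed : ∀ {y} → φ y ≤ y → μ ≤ y
    μ≤prefixed {y} φy≤y = ⋁-least proj₁ y λ (_ , below) → below y φy≤y

    μ-prefixed : φ μ ≤ μ
    μ-prefixed = ⋁-upper proj₁ (φ μ , λ y φy≤y → ≤-trans (φ-mono (μ≤prefixed φy≤y)) φy≤y)

    μ-fixed : φ μ ≡ μ
    μ-fixed = ≤-antisym μ-prefixed (μ≤prefixed (φ-mono μ-prefixed))

    lfp≤prefixed : ∀ {l y} → IsLeastFixedPoint L φ l → φ y ≤ y → l ≤ y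
    lfp≤prefixed (_ , least) φy≤y = ≤-trans (least μ μ-fixed) (μ≤prefixed φy≤y)

module SupPreservingMap {c ℓ : Level} {L M : CompleteLattice c ℓ}
    (f : CompleteLattice.Carrier L → CompleteLattice.Carrier M)
    (f-⋁ : ∀ {I : Set (c ⊔ ℓ)} (g : I → CompleteLattice.Carrier L) →
           f (CompleteLattice.⋁ L g) ≡ CompleteLattice.⋁ M (f ∘′ g)) where
  private
    module L = CompleteLattice L
    module M = CompleteLattice M

  rightAdjoint : M.Carrier → L.Carrier
  rightAdjoint b = L.⋁ {I = Σ L.Carrier λ a → f a M.≤ b} proj₁

  ≤-rightAdjoint : ∀ {a b} → f a M.≤ b → a L.≤ rightAdjoint b
  ≤-rightAdjoint fa≤b = L.⋁-upper proj₁ (_ , fa≤b)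

  rightAdjoint-counit : ∀ b → f (rightAdjoint b) M.≤ b
  rightAdjoint-counit b = M.≤-trans
    (CompleteLatticeProperties.≤-reflexive M (f-⋁ proj₁))
    (M.⋁-least _ b proj₂)

module _ {o h c ℓ : Level} {C : Category o h} (Q : SLattFunctor C c ℓ)
    (F : Functor C C) (Ψ : LaxFamily Q F) where
  open Category C
  open SLattFunctor Q
  open Functor F
  open LaxFamily Ψ
  private
    module L X = CompleteLattice (Q₀ X)
    module P X = CompleteLatticeProperties (Q₀ X)
    F̄ = lifting Q F Ψ

  underlyingCoalgebra : Coalgebra F̄ → Coalgebra F
  underlyingCoalgebra (coalg (X , _) γ) = coalg X (arr γ)

  underlyingCoalgHom : ∀ {A B} → CoalgHom F̄ A B →
                       CoalgHom F (underlyingCoalgebra A) (underlyingCoalgebra B)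
  underlyingCoalgHom u = record { arr = arr (CoalgHom.arr u) ; comm = cong arr (CoalgHom.comm u) }

  underlyingAlgebra : Algebra F̄ → Algebra F
  underlyingAlgebra (alg (X , _) γ) = alg X (arr γ)

  underlyingAlgHom : ∀ {A B} → AlgHom F̄ A B →
                     AlgHom F (underlyingAlgebra A) (underlyingAlgebra B)
  underlyingAlgHom u = record { arr = arr (AlgHom.arr u) ; comm = cong arr (AlgHom.comm u) }

  terminalCoalgebra-lifts : (T : Coalgebra F̄) → IsTerminalCoalgebra F (underlyingCoalgebra T) →
    (∀ {X} {α : ∣ Q ∣ X} {γ : Hom X (F₀ X)} → L._≤_ (F₀ X) (Q₁ γ α) (ψ X α) →
      (u : CoalgHom F (coalg X γ) (underlyingCoalgebra T)) →
      L._≤_ _ (Q₁ (CoalgHom.arr u) α) (proj₂ (Coalgebra.carrier T))) →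
    IsTerminalCoalgebra F̄ T
  terminalCoalgebra-lifts T terminal image≤label A@(coalg (X , α) (∫arr γ Q₁γα≤ψα)) =
    ū , λ v → ∫≡ Q (unique (underlyingCoalgHom v))
    where
      u = proj₁ (terminal (coalg X γ))
      unique = proj₂ (terminal (coalg X γ))
      ū : CoalgHom F̄ A T
      ū = record { arr = ∫arr (CoalgHom.arr u) (image≤label Q₁γα≤ψα u)
                 ; comm = ∫≡ Q (CoalgHom.comm u) }

  initialAlgebra-lifts : (I : Algebra F̄) → IsInitialAlgebra F (underlyingAlgebra I) →
    (∀ {X} {α : ∣ Q ∣ X} {γ : Hom (F₀ X) X} → L._≤_ X (Q₁ γ (ψ X α)) α →
      (u : AlgHom F (underlyingAlgebra I) (alg X γ)) →
      L._≤_ X (Q₁ (AlgHom.arr u) (proj₂ (Algebra.carrier I))) α) →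
    IsInitialAlgebra F̄ I
  initialAlgebra-lifts I initial image≤label A@(alg (X , α) (∫arr γ Q₁γψα≤α)) =
    ū , λ v → ∫≡ Q (unique (underlyingAlgHom v))
    where
      u = proj₁ (initial (alg X γ))
      unique = proj₂ (initial (alg X γ))
      ū : AlgHom F̄ I A
      ū = record { arr = ∫arr (AlgHom.arr u) (image≤label Q₁γψα≤α u)
                 ; comm = ∫≡ Q (AlgHom.comm u) }

  coalgHom-unfold : ∀ {X νF} {γ : Hom X (F₀ X)} {χ : Hom νF (F₀ νF)} {χ⁻¹ : Hom (F₀ νF) νF} →
    χ⁻¹ ∘ χ ≡ idC → (u : CoalgHom F (coalg X γ) (coalg νF χ)) →
    CoalgHom.arr u ≡ χ⁻¹ ∘ (F₁ (CoalgHom.arr u) ∘ γ)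
  coalgHom-unfold {γ = γ} {χ} {χ⁻¹} χ⁻¹∘χ≡id u = begin
    arrᵤ                     ≡⟨ sym identityˡ ⟩
    idC ∘ arrᵤ               ≡⟨ cong (_∘ arrᵤ) (sym χ⁻¹∘χ≡id) ⟩
    (χ⁻¹ ∘ χ) ∘ arrᵤ         ≡⟨ assoc ⟩
    χ⁻¹ ∘ (χ ∘ arrᵤ)         ≡⟨ cong (χ⁻¹ ∘_) (CoalgHom.comm u) ⟩
    χ⁻¹ ∘ (F₁ arrᵤ ∘ γ)      ∎
    where
      open ≡-Reasoning
      arrᵤ = CoalgHom.arr u

  coalgHom-image-postfixed : ∀ {X νF} {γ : Hom X (F₀ X)} {α : ∣ Q ∣ X}
    {χ : Hom νF (F₀ νF)} {χ⁻¹ : Hom (F₀ νF) νF} →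
    χ⁻¹ ∘ χ ≡ idC → L._≤_ (F₀ X) (Q₁ γ α) (ψ X α) →
    (u : CoalgHom F (coalg X γ) (coalg νF χ)) →
    L._≤_ νF (Q₁ (CoalgHom.arr u) α) (Q₁ χ⁻¹ (ψ νF (Q₁ (CoalgHom.arr u) α)))
  coalgHom-image-postfixed {X} {νF} {γ} {α} {χ⁻¹ = χ⁻¹} χ⁻¹∘χ≡id γα≤ψα u = begin
    Q₁ arrᵤ α                              ≡⟨ cong (λ k → Q₁ k α) (coalgHom-unfold χ⁻¹∘χ≡id u) ⟩
    Q₁ (χ⁻¹ ∘ (F₁ arrᵤ ∘ γ)) α             ≡⟨ Q-∘ _ χ⁻¹ α ⟩
    Q₁ χ⁻¹ (Q₁ (F₁ arrᵤ ∘ γ) α)            ≡⟨ cong (Q₁ χ⁻¹) (Q-∘ γ (F₁ arrᵤ) α) ⟩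
    Q₁ χ⁻¹ (Q₁ (F₁ arrᵤ) (Q₁ γ α))         ≤⟨ Q₁-mono Q χ⁻¹ (Q₁-mono Q (F₁ arrᵤ) γα≤ψα) ⟩
    Q₁ χ⁻¹ (Q₁ (F₁ arrᵤ) (ψ X α))          ≤⟨ Q₁-mono Q χ⁻¹ (ψ-lax arrᵤ α) ⟩
    Q₁ χ⁻¹ (ψ νF (Q₁ arrᵤ α))              ∎
    where
      open P.≤-Reasoning νF
      arrᵤ = CoalgHom.arr u

  algHom-intertwines : IsNatural Q F Ψ → ∀ {X μF} {γ : Hom (F₀ X) X} {χ : Hom (F₀ μF) μF} →
    (u : AlgHom F (alg μF χ) (alg X γ)) → ∀ a →
    Q₁ (AlgHom.arr u) (Q₁ χ (ψ μF a)) ≡ Q₁ γ (ψ X (Q₁ (AlgHom.arr u) a))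
  algHom-intertwines natural {X} {μF} {γ} {χ} u a = begin
    Q₁ arrᵤ (Q₁ χ (ψ μF a))              ≡⟨ sym (Q-∘ χ arrᵤ _) ⟩
    Q₁ (arrᵤ ∘ χ) (ψ μF a)               ≡⟨ cong (λ k → Q₁ k (ψ μF a)) (AlgHom.comm u) ⟩
    Q₁ (γ ∘ F₁ arrᵤ) (ψ μF a)            ≡⟨ Q-∘ (F₁ arrᵤ) γ _ ⟩
    Q₁ γ (Q₁ (F₁ arrᵤ) (ψ μF a))         ≡⟨ cong (Q₁ γ) (natural arrᵤ a) ⟩
    Q₁ γ (ψ X (Q₁ arrᵤ a))               ∎
    where
      open ≡-Reasoning
      arrᵤ = AlgHom.arr u

  module Q₁-Adjoint {X Y} (f : Hom X Y) = SupPreservingMap {L = Q₀ X} {Q₀ Y} (Q₁ f) (Q₁-⋁ f)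

  rightAdjoint-prefixed : IsNatural Q F Ψ →
    ∀ {X μF} {γ : Hom (F₀ X) X} {α : ∣ Q ∣ X} {χ : Hom (F₀ μF) μF} →
    L._≤_ X (Q₁ γ (ψ X α)) α → (u : AlgHom F (alg μF χ) (alg X γ)) →
    let a = Q₁-Adjoint.rightAdjoint (AlgHom.arr u) α in
    L._≤_ μF (Q₁ χ (ψ μF a)) a
  rightAdjoint-prefixed natural {X} {μF} {γ} {α} {χ} γψα≤α u =
    Q₁-Adjoint.≤-rightAdjoint arrᵤ (begin
      Q₁ arrᵤ (Q₁ χ (ψ μF a))    ≡⟨ algHom-intertwines natural u a ⟩
      Q₁ γ (ψ X (Q₁ arrᵤ a))     ≤⟨ Q₁-mono Q γ (ψ-mono X (Q₁-Adjoint.rightAdjoint-counit arrᵤ α)) ⟩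
      Q₁ γ (ψ X α)               ≤⟨ γψα≤α ⟩
      α                          ∎)
    where
      open P.≤-Reasoning X
      arrᵤ = AlgHom.arr u
      a = Q₁-Adjoint.rightAdjoint arrᵤ α

  terminalCoalgebra-liftsAtGfp : (νF : Obj) (χ : Hom νF (F₀ νF)) →
    IsTerminalCoalgebra F (coalg νF χ) →
    (χ⁻¹ : Hom (F₀ νF) νF) → χ⁻¹ ∘ χ ≡ idC → χ ∘ χ⁻¹ ≡ idC →
    (g : ∣ Q ∣ νF) → IsGreatestFixedPoint (Q₀ νF) (λ a → Q₁ χ⁻¹ (ψ νF a)) g →
    Σ (∫Hom Q (νF , g) (Functor.F₀ F̄ (νF , g))) λ χ̄ →
      (arr χ̄ ≡ χ) × IsTerminalCoalgebra F̄ (coalg (νF , g) χ̄)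
  terminalCoalgebra-liftsAtGfp νF χ terminal χ⁻¹ χ⁻¹∘χ≡id χ∘χ⁻¹≡id g gfp =
    χ̄ , refl , terminalCoalgebra-lifts (coalg (νF , g) χ̄) terminal image≤g
    where
      open P.KnasterTarski νF (λ a → Q₁ χ⁻¹ (ψ νF a)) (Q₁-mono Q χ⁻¹ ∘′ ψ-mono νF)
      open ≡-Reasoning

      Q₁χg≡ψg : Q₁ χ g ≡ ψ νF g
      Q₁χg≡ψg = begin
        Q₁ χ g                      ≡⟨ cong (Q₁ χ) (sym (proj₁ gfp)) ⟩
        Q₁ χ (Q₁ χ⁻¹ (ψ νF g))      ≡⟨ sym (Q-∘ χ⁻¹ χ _) ⟩
        Q₁ (χ ∘ χ⁻¹) (ψ νF g)       ≡⟨ cong (λ k → Q₁ k (ψ νF g)) χ∘χ⁻¹≡id ⟩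
        Q₁ idC (ψ νF g)             ≡⟨ Q-id _ ⟩
        ψ νF g                      ∎

      χ̄ : ∫Hom Q (νF , g) (F₀ νF , ψ νF g)
      χ̄ = ∫arr χ (P.≤-reflexive _ Q₁χg≡ψg)

      image≤g : ∀ {X} {α : ∣ Q ∣ X} {γ : Hom X (F₀ X)} → L._≤_ (F₀ X) (Q₁ γ α) (ψ X α) →
                (u : CoalgHom F (coalg X γ) (coalg νF χ)) → L._≤_ νF (Q₁ (CoalgHom.arr u) α) g
      image≤g Q₁γα≤ψα u = postfixed≤gfp gfp (coalgHom-image-postfixed χ⁻¹∘χ≡id Q₁γα≤ψα u)

  initialAlgebra-liftsAtLfp : IsNatural Q F Ψ → (μF : Obj) (χ : Hom (F₀ μF) μF) →
    IsInitialAlgebra F (alg μF χ) →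
    (l : ∣ Q ∣ μF) → IsLeastFixedPoint (Q₀ μF) (λ a → Q₁ χ (ψ μF a)) l →
    Σ (∫Hom Q (Functor.F₀ F̄ (μF , l)) (μF , l)) λ χ̄ →
      (arr χ̄ ≡ χ) × IsInitialAlgebra F̄ (alg (μF , l) χ̄)
  initialAlgebra-liftsAtLfp natural μF χ initial l lfp =
    χ̄ , refl , initialAlgebra-lifts (alg (μF , l) χ̄) initial image≤label
    where
      open P.KnasterTarski μF (λ a → Q₁ χ (ψ μF a)) (Q₁-mono Q χ ∘′ ψ-mono μF)

      χ̄ : ∫Hom Q (F₀ μF , ψ μF l) (μF , l)
      χ̄ = ∫arr χ (P.≤-reflexive _ (proj₁ lfp))

      image≤label : ∀ {X} {α : ∣ Q ∣ X} {γ : Hom (F₀ X) X} → L._≤_ X (Q₁ γ (ψ X α)) α →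
                    (u : AlgHom F (alg μF χ) (alg X γ)) → L._≤_ X (Q₁ (AlgHom.arr u) l) α
      image≤label {X} {α} Q₁γψα≤α u = begin
        Q₁ arrᵤ l                                ≤⟨ Q₁-mono Q arrᵤ l≤u⁎α ⟩
        Q₁ arrᵤ (Q₁-Adjoint.rightAdjoint arrᵤ α) ≤⟨ Q₁-Adjoint.rightAdjoint-counit arrᵤ α ⟩
        α                                        ∎
        where
          open P.≤-Reasoning X
          arrᵤ = AlgHom.arr u
          l≤u⁎α = lfp≤prefixed lfp (rightAdjoint-prefixed natural Q₁γψα≤α u)

mainTheorem19 : {o h c ℓ : Level} (C : Category o h) (Q : SLattFunctor C c ℓ)
    (F : Functor C C) (Ψ : LaxFamily Q F) →
    -- (1) terminal coalgebras lift
    ((νF : Category.Obj C) (χ : Category.Hom C νF (Functor.F₀ F νF)) →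
      IsTerminalCoalgebra F (coalg νF χ) →
      (χ⁻¹ : Category.Hom C (Functor.F₀ F νF) νF) →
      Category._∘_ C χ⁻¹ χ ≡ Category.idC C →
      Category._∘_ C χ χ⁻¹ ≡ Category.idC C →
      (g : ∣ Q ∣ νF) →
      IsGreatestFixedPoint (SLattFunctor.Q₀ Q νF)
        (λ a → SLattFunctor.Q₁ Q χ⁻¹ (LaxFamily.ψ Ψ νF a)) g →
      Σ (∫Hom Q (νF , g) (Functor.F₀ (lifting Q F Ψ) (νF , g))) λ χ̄ →
        (∫Hom.arr χ̄ ≡ χ) × IsTerminalCoalgebra (lifting Q F Ψ) (coalg (νF , g) χ̄))
    ×
    -- (2) if ψ is natural, initial algebras lift
    (IsNatural Q F Ψ →
      (μF : Category.Obj C) (χ : Category.Hom C (Functor.F₀ F μF) μF) →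
      IsInitialAlgebra F (alg μF χ) →
      (l : ∣ Q ∣ μF) →
      IsLeastFixedPoint (SLattFunctor.Q₀ Q μF)
        (λ a → SLattFunctor.Q₁ Q χ (LaxFamily.ψ Ψ μF a)) l →
      Σ (∫Hom Q (Functor.F₀ (lifting Q F Ψ) (μF , l)) (μF , l)) λ χ̄ →
        (∫Hom.arr χ̄ ≡ χ) × IsInitialAlgebra (lifting Q F Ψ) (alg (μF , l) χ̄))
mainTheorem19 C Q F Ψ =
  terminalCoalgebra-liftsAtGfp Q F Ψ , initialAlgebra-liftsAtLfp Q F Ψ
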